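{- For every $\phi\in\mathcal{L}$ and all distinct individual variables $x,y$: $Th\models_{fo}\exists x\big(Sx\wedge(\forall y)_O(Eyx\leftrightarrow ST_y(\phi))\big)$.
   Context: $\mathcal{L}$ is built from a countably infinite set $Var$ of propositional variables and $\top,\bot$ by $\wedge,\vee,\to$ and conditional connectives $\phi\mathbin{\Box\!\!\to}\psi$, $\phi\mathbin{\Diamond\!\!\to}\psi$. $\mathcal{L}_{fo}$ has individual variables, atoms $px$ ($p\in Var$), $Rxyz$, $Ox$, $Sx$, $Exy$, $x\equiv y$, $\top,\bot$, connectives $\wedge,\vee,\to$, quantifiers; $\neg\phi:=\phi\to\bot$; $(\forall x)_O\phi:=\forall x(Ox\to\phi)$. $\models_{fo}$ is intuitionistic first-order consequence via Kripke sheaves: a preorder of worlds, classical structures at each world for this signature, and homomorphisms $\mathbb{H}_{wv}$ for $w\leq v$ (identity for $w\leq w$, composing along chains), with the usual intuitionistic forcing clauses ($\to$ and $\forall$ quantify over all later worlds, transporting the assignment along $\mathbb{H}$; $\equiv$ is identity); $\Sigma\models_{fo}\Pi$ iff no world and assignment force all of $\Sigma$ and none of $\Pi$. $Th$ consists of: $\forall x(Sx\vee Ox)$; $\forall x\neg(Sx\wedge Ox)$; $\forall x(px\to Ox)$ for $p\in Var$; $\forall x\forall y(Exy\to(Ox\wedge Sy))$; $\forall x\forall y\forall z(Rxyz\to(Ox\wedge Sy\wedge Oz))$; $\exists x(Sx\wedge\forall y(Eyx\leftrightarrow py))$ for $p\in Var$; $\exists x(Sx\wedge(\forall y)_O Eyx)$;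 $\exists x(Sx\wedge\forall y\neg Eyx)$; $\forall x\forall y((Sx\wedge Sy)\to\exists z(Sz\wedge(\forall w)_O(Ewz\leftrightarrow(Ewx\ast Ewy))))$ for $\ast\in\{\wedge,\vee,\to\}$; $\forall x\forall y((Sx\wedge Sy)\to\exists z(Sz\wedge(\forall w)_O(Ewz\leftrightarrow\forall u(Rwxu\to Euy))))$; $\forall x\forall y((Sx\wedge Sy)\to\exists z(Sz\wedge(\forall w)_O(Ewz\leftrightarrow\exists u(Rwxu\wedge Euy))))$; $\forall x\forall y((Sx\wedge Sy\wedge(\forall z)_O(Ezx\leftrightarrow Ezy))\to x\equiv y)$. Standard translation (with $x,y,z,w$ pairwise distinct): $ST_x(p)=px$; $ST_x(\top)=\top$, $ST_x(\bot)=\bot$; $ST_x(\psi\ast\chi)=ST_x(\psi)\ast ST_x(\chi)$ for $\ast\in\{\wedge,\vee,\to\}$; $ST_x(\psi\mathbin{\Box\!\!\to}\chi)=\exists y(Sy\wedge(\forall z)_O(Ezy\leftrightarrow ST_z(\psi))\wedge\forall w(Rxyw\to ST_w(\chi)))$; $ST_x(\psi\mathbin{\Diamond\!\!\to}\chi)=\exists y(Sy\wedge(\forall z)_O(Ezy\leftrightarrow ST_z(\psi))\wedge\exists w(Rxyw\wedge ST_w(\chi)))$. -}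

module Defs where

open import Data.Nat using (ℕ; suc; _+_; _≟_)
open import Data.Product using (Σ; _×_; _,_)
open import Data.Sum using (_⊎_)
open import Data.Unit using (⊤)
open import Data.Empty using (⊥)
open import Relation.Nullary using (¬_; yes; no)
open import Relation.Binary.PropositionalEquality using (_≡_)

PVar : Set
PVar = ℕ

IVar : Set
IVar = ℕ

infixr 6 _∧ᴸ_
infixr 5 _∨ᴸ_
infixr 4 _⇒ᴸ_ _□→_ _◇→_

data 𝓛 : Set where
  var  : PVar → 𝓛
  ⊤ᴸ   : 𝓛
  ⊥ᴸ   : 𝓛
  _∧ᴸ_ : 𝓛 → 𝓛 → 𝓛
  _∨ᴸ_ : 𝓛 → 𝓛 → 𝓛
  _⇒ᴸ_ : 𝓛 → 𝓛 → 𝓛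
  _□→_ : 𝓛 → 𝓛 → 𝓛
  _◇→_ : 𝓛 → 𝓛 → 𝓛

infixr 6 _∧_
infixr 5 _∨_
infixr 4 _⇒_ _⇔_

data FO : Set where
  P   : PVar → IVar → FO
  R   : IVar → IVar → IVar → FO
  O   : IVar → FO
  S   : IVar → FO
  E   : IVar → IVar → FO
  _≐_ : IVar → IVar → FO
  ⊤ᶠ  : FO
  ⊥ᶠ  : FO
  _∧_ : FO → FO → FO
  _∨_ : FO → FO → FO
  _⇒_ : FO → FO → FO
  ∀′  : IVar → FO → FO
  ∃′  : IVar → FO → FO

¬ᶠ : FO → FO
¬ᶠ φ = φ ⇒ ⊥ᶠ

_⇔_ : FO → FO → FO
φ ⇔ ψ = (φ ⇒ ψ) ∧ (ψ ⇒ φ)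

∀O : IVar → FO → FO
∀O x φ = ∀′ x (O x ⇒ φ)

record KripkeSheaf : Set₁ where
  field
    W     : Set
    _≤_   : W → W → Set
    ≤-refl  : ∀ {w} → w ≤ w
    ≤-trans : ∀ {w v u} → w ≤ v → v ≤ u → w ≤ u
    D     : W → Set
    Pᴵ    : ∀ {w} → PVar → D w → Set
    Rᴵ    : ∀ {w} → D w → D w → D w → Set
    Oᴵ    : ∀ {w} → D w → Set
    Sᴵ    : ∀ {w} → D w → Set
    Eᴵ    : ∀ {w} → D w → D w → Set
    H     : ∀ {w v} → w ≤ v → D w → D v
    H-id   : ∀ {w} (p : w ≤ w) (a : D w) → H p a ≡ a
    H-comp : ∀ {w v u} (p : w ≤ v) (q : v ≤ u) (r : w ≤ u) (a : D w) →
             H r a ≡ H q (H p a)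
    H-P : ∀ {w v} (p : w ≤ v) (q : PVar) (a : D w) → Pᴵ q a → Pᴵ q (H p a)
    H-R : ∀ {w v} (p : w ≤ v) (a b c : D w) → Rᴵ a b c → Rᴵ (H p a) (H p b) (H p c)
    H-O : ∀ {w v} (p : w ≤ v) (a : D w) → Oᴵ a → Oᴵ (H p a)
    H-S : ∀ {w v} (p : w ≤ v) (a : D w) → Sᴵ a → Sᴵ (H p a)
    H-E : ∀ {w v} (p : w ≤ v) (a b : D w) → Eᴵ a b → Eᴵ (H p a) (H p b)

module Forcing (M : KripkeSheaf) where
  open KripkeSheaf M

  Assignment : W → Set
  Assignment w = IVar → D w

  _[_↦_] : ∀ {w} → Assignment w → IVar → D w → Assignment w
  (σ [ x ↦ d ]) y with x ≟ y
  ... | yes _ = d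
  ... | no  _ = σ y

  transport : ∀ {w v} → w ≤ v → Assignment w → Assignment v
  transport p σ y = H p (σ y)

  _,_⊩_ : (w : W) → Assignment w → FO → Set
  w , σ ⊩ P q x     = Pᴵ q (σ x)
  w , σ ⊩ R x y z   = Rᴵ (σ x) (σ y) (σ z)
  w , σ ⊩ O x       = Oᴵ (σ x)
  w , σ ⊩ S x       = Sᴵ (σ x)
  w , σ ⊩ E x y     = Eᴵ (σ x) (σ y)
  w , σ ⊩ (x ≐ y)   = σ x ≡ σ y
  w , σ ⊩ ⊤ᶠ        = ⊤
  w , σ ⊩ ⊥ᶠ        = ⊥
  w , σ ⊩ (φ ∧ ψ)   = (w , σ ⊩ φ) × (w , σ ⊩ ψ)
  w , σ ⊩ (φ ∨ ψ)   = (w , σ ⊩ φ) ⊎ (w , σ ⊩ ψ)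
  w , σ ⊩ (φ ⇒ ψ)   = ∀ v (p : w ≤ v) →
                        v , transport p σ ⊩ φ → v , transport p σ ⊩ ψ
  w , σ ⊩ ∀′ x φ    = ∀ v (p : w ≤ v) (d : D v) → v , (transport p σ [ x ↦ d ]) ⊩ φ
  w , σ ⊩ ∃′ x φ    = Σ (D w) λ d → w , (σ [ x ↦ d ]) ⊩ φ

-- Σ ⊨fo Π : no world and assignment (in any Kripke sheaf) force all of Σ
-- and none of Π.  Sets of formulas are predicates on FO.
_⊨fo_ : (FO → Set) → (FO → Set) → Set₁
Γ ⊨fo Π = ∀ (M : KripkeSheaf) (w : KripkeSheaf.W M) (σ : Forcing.Assignment M w) →
          (∀ φ → Γ φ → Forcing._,_⊩_ M w σ φ) →
          (∀ ψ → Π ψ → ¬ Forcing._,_⊩_ M w σ ψ) → ⊥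

⟦_⟧ : FO → FO → Set
⟦ ψ ⟧ χ = χ ≡ ψ

-- The theory Th (closed formulas; bound variable names 0,1,2,3,4 chosen
-- pairwise distinct)

data BinOp : Set where
  and or imp : BinOp

applyOp : BinOp → FO → FO → FO
applyOp and φ ψ = φ ∧ ψ
applyOp or  φ ψ = φ ∨ ψ
applyOp imp φ ψ = φ ⇒ ψ

private
  x₀ y₀ z₀ w₀ u₀ : IVar
  x₀ = 0
  y₀ = 1
  z₀ = 2
  w₀ = 3
  u₀ = 4

data Th : FO → Set where
  th-SO    : Th (∀′ x₀ (S x₀ ∨ O x₀))
  th-¬SO   : Th (∀′ x₀ (¬ᶠ (S x₀ ∧ O x₀)))
  th-pO    : ∀ q → Th (∀′ x₀ (P q x₀ ⇒ O x₀))
  th-E     : Th (∀′ x₀ (∀′ y₀ (E x₀ y₀ ⇒ (O x₀ ∧ S y₀))))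
  th-R     : Th (∀′ x₀ (∀′ y₀ (∀′ z₀ (R x₀ y₀ z₀ ⇒ (O x₀ ∧ S y₀ ∧ O z₀)))))
  th-p     : ∀ q → Th (∃′ x₀ (S x₀ ∧ ∀′ y₀ (E y₀ x₀ ⇔ P q y₀)))
  th-top   : Th (∃′ x₀ (S x₀ ∧ ∀O y₀ (E y₀ x₀)))
  th-bot   : Th (∃′ x₀ (S x₀ ∧ ∀′ y₀ (¬ᶠ (E y₀ x₀))))
  th-op    : ∀ ∗ → Th (∀′ x₀ (∀′ y₀ ((S x₀ ∧ S y₀) ⇒
               ∃′ z₀ (S z₀ ∧ ∀O w₀ (E w₀ z₀ ⇔ applyOp ∗ (E w₀ x₀) (E w₀ y₀))))))
  th-box   : Th (∀′ x₀ (∀′ y₀ ((S x₀ ∧ S y₀) ⇒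
               ∃′ z₀ (S z₀ ∧ ∀O w₀ (E w₀ z₀ ⇔ ∀′ u₀ (R w₀ x₀ u₀ ⇒ E u₀ y₀))))))
  th-dia   : Th (∀′ x₀ (∀′ y₀ ((S x₀ ∧ S y₀) ⇒
               ∃′ z₀ (S z₀ ∧ ∀O w₀ (E w₀ z₀ ⇔ ∃′ u₀ (R w₀ x₀ u₀ ∧ E u₀ y₀))))))
  th-ext   : Th (∀′ x₀ (∀′ y₀ ((S x₀ ∧ S y₀ ∧ ∀O z₀ (E z₀ x₀ ⇔ E z₀ y₀)) ⇒ (x₀ ≐ y₀))))

-- Standard translation.  For ST_x the auxiliary variables are chosen as
-- y = x+1, z = x+2, w = x+3 (so x,y,z,w are pairwise distinct).

ST : IVar → 𝓛 → FO
ST x (var q)   = P q x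
ST x ⊤ᴸ        = ⊤ᶠ
ST x ⊥ᴸ        = ⊥ᶠ
ST x (φ ∧ᴸ ψ)  = ST x φ ∧ ST x ψ
ST x (φ ∨ᴸ ψ)  = ST x φ ∨ ST x ψ
ST x (φ ⇒ᴸ ψ)  = ST x φ ⇒ ST x ψ
ST x (φ □→ ψ)  = ∃′ y (S y ∧ ∀O z (E z y ⇔ ST z φ) ∧ ∀′ w (R x y w ⇒ ST w ψ))
  where y = x + 1
        z = x + 2
        w = x + 3
ST x (φ ◇→ ψ)  = ∃′ y (S y ∧ ∀O z (E z y ⇔ ST z φ) ∧ ∃′ w (R x y w ∧ ST w ψ))
  where y = x + 1
        z = x + 2
        w = x + 3

{-# OPTIONS --safe #-}
-- Interpret every φ ∈ 𝓛 in a Kripke sheaf as a persistent predicate ‖ φ ‖ on objects, and say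
-- that a state s (an S-object) represents a predicate when, at every later world, the O-objects
-- E-related to s are exactly those satisfying it.  Two facts give the theorem.  First, the
-- standard translation is correct: ST y φ is forced iff ‖ φ ‖ holds of the value of y, so
-- ∀O y (E y x ⇔ ST y φ) says precisely that the value of x represents ‖ φ ‖.  Second, in a
-- model of Th every ‖ φ ‖ is represented, by induction on φ: atoms, ⊤ and ⊥ by the existence
-- axioms, the connectives by the closure axioms applied to the states representing the
-- immediate subformulas.  For φ □→ ψ and φ ◇→ ψ the translation quantifies over some state
-- representing φ, and extensionality identifies it with the one given by induction.
module Submission where

open import Defs
open import Data.Nat using (_+_; _≟_)
open import Data.Nat.Properties using (+-cancelˡ-≡; m+1+n≢m)
open import Data.Product using (Σ; _×_; _,_; proj₁; proj₂)
open import Data.Product.Function.NonDependent.Propositional using (_×-⇔_)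
import Data.Product.Function.Dependent.Propositional as Σ
open import Function.Related.Propositional using (equivalence)
open import Function.Related.TypeIsomorphisms using (→-cong-⇔)
open import Data.Sum using (_⊎_; inj₁; inj₂)
open import Data.Sum.Function.Propositional using (_⊎-⇔_)
open import Data.Unit using (⊤; tt)
open import Data.Empty using (⊥; ⊥-elim)
open import Function.Base using (_∘_)
-- Defs already uses _⇔_ for the object-level biconditional.
open import Function.Bundles using (Equivalence; mk⇔) renaming (_⇔_ to _⟺_)
open import Function.Construct.Composition using (_⇔-∘_)
open import Function.Construct.Symmetry using (⇔-sym)
open import Function.Construct.Identity using (⇔-id)
open import Relation.Nullary using (yes; no)
open import Relation.Binary.PropositionalEquality
  using (_≡_; _≢_; _≗_; refl; sym; trans; cong; subst; subst₂)

open Equivalence using (to; from)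

subst-⟺ : {A : Set} (B : A → Set) {a a′ : A} → a ≡ a′ → B a ⟺ B a′
subst-⟺ B refl = ⇔-id _

+-≢ : ∀ y {m n} → m ≢ n → y + m ≢ y + n
+-≢ y m≢n = m≢n ∘ +-cancelˡ-≡ y _ _

module ST-variables (y : IVar) where
  y₁ y₂ y₃ : IVar
  y₁ = y + 1
  y₂ = y + 2
  y₃ = y + 3

  y₁≢y : y₁ ≢ y
  y₁≢y = m+1+n≢m y

  y₃≢y : y₃ ≢ y
  y₃≢y = m+1+n≢m y

  y₂≢y₁ : y₂ ≢ y₁
  y₂≢y₁ = +-≢ y λ ()

  y₃≢y₁ : y₃ ≢ y₁
  y₃≢y₁ = +-≢ y λ ()

module Semantics (M : KripkeSheaf) where
  open KripkeSheaf M
  open Forcing M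

  private variable
    w v u : W
    x : IVar
    d : D w

  update-same : (σ : Assignment w) (x : IVar) (d : D w) → (σ [ x ↦ d ]) x ≡ d
  update-same σ x d with x ≟ x
  ... | yes _ = refl
  ... | no x≢x = ⊥-elim (x≢x refl)

  update-other : (σ : Assignment w) {x y : IVar} (d : D w) → x ≢ y →
                 (σ [ x ↦ d ]) y ≡ σ y
  update-other σ {x} {y} d x≢y with x ≟ y
  ... | yes x≡y = ⊥-elim (x≢y x≡y)
  ... | no _ = refl

  update-cong : {σ τ : Assignment w} → σ ≗ τ → σ [ x ↦ d ] ≗ τ [ x ↦ d ]
  update-cong {x = x} σ≗τ y with x ≟ y
  ... | yes _ = refl
  ... | no _ = σ≗τ y

  transport-cong : (p : w ≤ v) {σ τ : Assignment w} → σ ≗ τ →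
                   transport p σ ≗ transport p τ
  transport-cong p σ≗τ y = cong (H p) (σ≗τ y)

  transport-refl : (σ : Assignment w) → transport ≤-refl σ ≗ σ
  transport-refl σ y = H-id ≤-refl (σ y)

  transport-trans : (p : w ≤ v) (q : v ≤ u) (σ : Assignment w) →
                    transport q (transport p σ) ≗ transport (≤-trans p q) σ
  transport-trans p q σ y = sym (H-comp p q (≤-trans p q) (σ y))

  transport-update : (p : w ≤ v) (σ : Assignment w) →
                     transport p (σ [ x ↦ d ]) ≗ transport p σ [ x ↦ H p d ]
  transport-update {x = x} p σ y with x ≟ y
  ... | yes _ = refl
  ... | no _ = refl

  ⊩-resp-≗ : ∀ φ {σ τ : Assignment w} → σ ≗ τ → w , σ ⊩ φ → w , τ ⊩ φ
  ⊩-resp-≗ (P q x) σ≗τ = subst (Pᴵ q) (σ≗τ x)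
  ⊩-resp-≗ (R x y z) {τ = τ} σ≗τ r =
    subst (Rᴵ (τ x) (τ y)) (σ≗τ z) (subst₂ (λ a b → Rᴵ a b _) (σ≗τ x) (σ≗τ y) r)
  ⊩-resp-≗ (O x) σ≗τ = subst Oᴵ (σ≗τ x)
  ⊩-resp-≗ (S x) σ≗τ = subst Sᴵ (σ≗τ x)
  ⊩-resp-≗ (E x y) σ≗τ = subst₂ Eᴵ (σ≗τ x) (σ≗τ y)
  ⊩-resp-≗ (x ≐ y) σ≗τ eq = trans (sym (σ≗τ x)) (trans eq (σ≗τ y))
  ⊩-resp-≗ ⊤ᶠ σ≗τ t = t
  ⊩-resp-≗ ⊥ᶠ σ≗τ f = f
  ⊩-resp-≗ (φ ∧ ψ) σ≗τ (a , b) = ⊩-resp-≗ φ σ≗τ a , ⊩-resp-≗ ψ σ≗τ b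
  ⊩-resp-≗ (φ ∨ ψ) σ≗τ (inj₁ a) = inj₁ (⊩-resp-≗ φ σ≗τ a)
  ⊩-resp-≗ (φ ∨ ψ) σ≗τ (inj₂ b) = inj₂ (⊩-resp-≗ ψ σ≗τ b)
  ⊩-resp-≗ (φ ⇒ ψ) σ≗τ f v p =
      ⊩-resp-≗ ψ (transport-cong p σ≗τ)
    ∘ f v p
    ∘ ⊩-resp-≗ φ (transport-cong p (λ y → sym (σ≗τ y)))
  ⊩-resp-≗ (∀′ x φ) σ≗τ f v p d =
    ⊩-resp-≗ φ (update-cong {x = x} (transport-cong p σ≗τ)) (f v p d)
  ⊩-resp-≗ (∃′ x φ) σ≗τ (d , a) = d , ⊩-resp-≗ φ (update-cong {x = x} σ≗τ) a

  ⊩-cong-≗ : ∀ φ {σ τ : Assignment w} → σ ≗ τ → (w , σ ⊩ φ) ⟺ (w , τ ⊩ φ)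
  ⊩-cong-≗ φ σ≗τ = mk⇔ (⊩-resp-≗ φ σ≗τ) (⊩-resp-≗ φ (λ y → sym (σ≗τ y)))

  ⊩-mono : ∀ φ {σ : Assignment w} (p : w ≤ v) → w , σ ⊩ φ → v , transport p σ ⊩ φ
  ⊩-mono (P q x) p = H-P p q _
  ⊩-mono (R x y z) p = H-R p _ _ _
  ⊩-mono (O x) p = H-O p _
  ⊩-mono (S x) p = H-S p _
  ⊩-mono (E x y) p = H-E p _ _
  ⊩-mono (x ≐ y) p = cong (H p)
  ⊩-mono ⊤ᶠ p t = t
  ⊩-mono ⊥ᶠ p ()
  ⊩-mono (φ ∧ ψ) p (a , b) = ⊩-mono φ p a , ⊩-mono ψ p b
  ⊩-mono (φ ∨ ψ) p (inj₁ a) = inj₁ (⊩-mono φ p a)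
  ⊩-mono (φ ∨ ψ) p (inj₂ b) = inj₂ (⊩-mono ψ p b)
  ⊩-mono (φ ⇒ ψ) {σ} p f u q =
      from (⊩-cong-≗ ψ (transport-trans p q σ))
    ∘ f u (≤-trans p q)
    ∘ to (⊩-cong-≗ φ (transport-trans p q σ))
  ⊩-mono (∀′ x φ) {σ} p f u q d =
    from (⊩-cong-≗ φ (update-cong {x = x} (transport-trans p q σ))) (f u (≤-trans p q) d)
  ⊩-mono (∃′ x φ) {σ} p (d , a) =
    H p d , ⊩-resp-≗ φ (transport-update {x = x} p σ) (⊩-mono φ p a)

  transport-extend : (p : w ≤ v) (q : v ≤ u) (σ : Assignment w) →
                     transport q (transport p σ [ x ↦ d ]) ≗
                     transport (≤-trans p q) σ [ x ↦ H q d ]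
  transport-extend {x = x} p q σ y =
    trans (transport-update {x = x} q (transport p σ) y)
          (update-cong {x = x} (transport-trans p q σ) y)

  ⊩⇔-intro : ∀ φ ψ {σ : Assignment w} →
             (∀ {v} (p : w ≤ v) → (v , transport p σ ⊩ φ) ⟺ (v , transport p σ ⊩ ψ)) →
             w , σ ⊩ (φ ⇔ ψ)
  ⊩⇔-intro φ ψ φ⟺ψ = (λ _ p → to (φ⟺ψ p)) , (λ _ p → from (φ⟺ψ p))

  ⊩⇒-elim : ∀ φ ψ (σ : Assignment w) → w , σ ⊩ (φ ⇒ ψ) → w , σ ⊩ φ → w , σ ⊩ ψ
  ⊩⇒-elim φ ψ σ f =
    to (⊩-cong-≗ ψ (transport-refl σ)) ∘ f _ ≤-refl ∘ from (⊩-cong-≗ φ (transport-refl σ))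

  ⊩∀-elim : ∀ x φ (σ : Assignment w) → w , σ ⊩ ∀′ x φ → (d : D w) → w , σ [ x ↦ d ] ⊩ φ
  ⊩∀-elim x φ σ f d = ⊩-resp-≗ φ (update-cong {x = x} (transport-refl σ)) (f _ ≤-refl d)

  ⊩∀∀⇒-elim : ∀ x y φ ψ (σ : Assignment w) → w , σ ⊩ ∀′ x (∀′ y (φ ⇒ ψ)) → ∀ a b →
               w , σ [ x ↦ a ] [ y ↦ b ] ⊩ φ → w , σ [ x ↦ a ] [ y ↦ b ] ⊩ ψ
  ⊩∀∀⇒-elim x y φ ψ σ f a b =
    ⊩⇒-elim φ ψ (σ [ x ↦ a ] [ y ↦ b ])
      (⊩∀-elim y (φ ⇒ ψ) (σ [ x ↦ a ]) (⊩∀-elim x (∀′ y (φ ⇒ ψ)) σ f a) b)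

  ⊩∀⇒⟺ : ∀ x φ ψ (σ : Assignment w) →
          (w , σ ⊩ ∀′ x (φ ⇒ ψ)) ⟺
          (∀ {v} (p : w ≤ v) d →
           v , transport p σ [ x ↦ d ] ⊩ φ → v , transport p σ [ x ↦ d ] ⊩ ψ)
  ⊩∀⇒⟺ x φ ψ σ = mk⇔
    (λ f {v} p d → ⊩⇒-elim φ ψ (transport p σ [ x ↦ d ]) (f v p d))
    (λ g v p d u q → let normal = transport-extend {x = x} {d = d} p q σ in
       from (⊩-cong-≗ ψ normal) ∘ g (≤-trans p q) (H q d) ∘ to (⊩-cong-≗ φ normal))

  ⊩R⟺ : {ρ : Assignment w} {x y z : IVar} {a b c : D w} →
        ρ x ≡ a → ρ y ≡ b → ρ z ≡ c → (w , ρ ⊩ R x y z) ⟺ Rᴵ a b c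
  ⊩R⟺ refl refl refl = ⇔-id _

  Pred : W → Set₁
  Pred w = ∀ {v} → w ≤ v → D v → Set

  Represents : Pred w → D w → Set
  Represents {w} Q s = ∀ {v} (p : w ≤ v) e → Oᴵ e → Eᴵ e (H p s) ⟺ Q p e

  Forced : Assignment w → IVar → FO → Pred w
  Forced σ z χ {v} p e = v , transport p σ [ z ↦ e ] ⊩ χ

  ⊩∀O⇔⟺ : ∀ z x χ (σ : Assignment w) → z ≢ x →
           (w , σ ⊩ ∀O z (E z x ⇔ χ)) ⟺ Represents (Forced σ z χ) (σ x)
  ⊩∀O⇔⟺ {w} z x χ σ z≢x = mk⇔ forward backward
    where
    module At {v} (p : w ≤ v) (e : D v) where
      ρ = transport p σ [ z ↦ e ]

      ρz : ρ z ≡ e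
      ρz = update-same (transport p σ) z e

      E-at : (v , ρ ⊩ E z x) ⟺ Eᴵ e (H p (σ x))
      E-at = mk⇔ (subst₂ Eᴵ ρz (update-other _ e z≢x))
                 (subst₂ Eᴵ (sym ρz) (sym (update-other _ e z≢x)))

    forward : w , σ ⊩ ∀O z (E z x ⇔ χ) → Represents (Forced σ z χ) (σ x)
    forward F p e o = mk⇔ (⊩⇒-elim (E z x) χ ρ (proj₁ iff) ∘ from E-at)
                          (to E-at ∘ ⊩⇒-elim χ (E z x) ρ (proj₂ iff))
      where
      open At p e
      iff = ⊩⇒-elim (O z) (E z x ⇔ χ) ρ (F _ p e) (subst Oᴵ (sym ρz) o)

    backward : Represents (Forced σ z χ) (σ x) → w , σ ⊩ ∀O z (E z x ⇔ χ)
    backward rep = from (⊩∀⇒⟺ z (O z) (E z x ⇔ χ) σ) λ p e o → ⊩⇔-intro (E z x) χ λ q →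
        ⊩-cong-≗ χ (λ y → sym (transport-extend {x = z} p q σ y))
        ⇔-∘ (rep (≤-trans p q) (H q e) (H-O q e (subst Oᴵ (At.ρz p e) o))
        ⇔-∘ (At.E-at (≤-trans p q) (H q e)
        ⇔-∘ ⊩-cong-≗ (E z x) (transport-extend {x = z} p q σ)))

  Represents-cong : {Q Q′ : Pred w} {s : D w} →
                    (∀ {v} (p : w ≤ v) e → Oᴵ e → Q p e ⟺ Q′ p e) →
                    Represents Q s ⟺ Represents Q′ s
  Represents-cong Q⟺Q′ = mk⇔ (λ rep {v} p e o → Q⟺Q′ p e o ⇔-∘ rep p e o)
                             (λ rep {v} p e o → ⇔-sym (Q⟺Q′ p e o) ⇔-∘ rep p e o)

  Represents-mono : {Q : Pred w} {s : D w} → Represents Q s →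
                    (p : w ≤ v) → Represents (λ q → Q (≤-trans p q)) (H p s)
  Represents-mono {s = s} rep p {u} q e o =
    rep (≤-trans p q) e o ⇔-∘ subst-⟺ (Eᴵ e) (sym (H-comp p q (≤-trans p q) s))

  _↑ : ((v : W) → D v → Set) → Pred w
  (Q ↑) {v} _ = Q v

  ‖_‖ : 𝓛 → (w : W) → D w → Set
  ‖ var q ‖ w a = Pᴵ q a
  ‖ ⊤ᴸ ‖ w a = ⊤
  ‖ ⊥ᴸ ‖ w a = ⊥
  ‖ φ ∧ᴸ ψ ‖ w a = ‖ φ ‖ w a × ‖ ψ ‖ w a
  ‖ φ ∨ᴸ ψ ‖ w a = ‖ φ ‖ w a ⊎ ‖ ψ ‖ w a
  ‖ φ ⇒ᴸ ψ ‖ w a = ∀ v (p : w ≤ v) → ‖ φ ‖ v (H p a) → ‖ ψ ‖ v (H p a)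
  ‖ φ □→ ψ ‖ w a = Σ (D w) λ s → Sᴵ s × Represents (‖ φ ‖ ↑) s ×
                     (∀ {v} (p : w ≤ v) c → Rᴵ (H p a) (H p s) c → ‖ ψ ‖ v c)
  ‖ φ ◇→ ψ ‖ w a = Σ (D w) λ s → Sᴵ s × Represents (‖ φ ‖ ↑) s ×
                     Σ (D w) λ c → Rᴵ a s c × ‖ ψ ‖ w c

  ST-correct : ∀ φ y (σ : Assignment w) → (w , σ ⊩ ST y φ) ⟺ ‖ φ ‖ w (σ y)

  ⊩∀O⇔ST⟺ : ∀ φ z x (σ : Assignment w) s → z ≢ x →
             (w , σ [ x ↦ s ] ⊩ ∀O z (E z x ⇔ ST z φ)) ⟺ Represents (‖ φ ‖ ↑) s
  ⊩∀O⇔ST⟺ φ z x σ s z≢x =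
        subst-⟺ (Represents (‖ φ ‖ ↑)) (update-same σ x s)
    ⇔-∘ (Represents-cong (λ p e _ → subst-⟺ (‖ φ ‖ _) (update-same _ z e)
                                   ⇔-∘ ST-correct φ z (transport p (σ [ x ↦ s ]) [ z ↦ e ]))
    ⇔-∘ ⊩∀O⇔⟺ z x (ST z φ) (σ [ x ↦ s ]) z≢x)

  ST-correct (var q) y σ = ⇔-id _
  ST-correct ⊤ᴸ y σ = ⇔-id _
  ST-correct ⊥ᴸ y σ = ⇔-id _
  ST-correct (φ ∧ᴸ ψ) y σ = ST-correct φ y σ ×-⇔ ST-correct ψ y σ
  ST-correct (φ ∨ᴸ ψ) y σ = ST-correct φ y σ ⊎-⇔ ST-correct ψ y σ
  ST-correct {w} (φ ⇒ᴸ ψ) y σ =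
    mk⇔ (λ f v p → to (at p) (f v p)) (λ f v p → from (at p) (f v p))
    where
    at : (p : w ≤ v) → (v , transport p σ ⊩ ST y φ → v , transport p σ ⊩ ST y ψ) ⟺
                       (‖ φ ‖ v (H p (σ y)) → ‖ ψ ‖ v (H p (σ y)))
    at p = →-cong-⇔ (ST-correct φ y (transport p σ)) (ST-correct ψ y (transport p σ))
  ST-correct {w} (φ □→ ψ) y σ = Σ.congˡ {k = equivalence} λ {s} →
        subst-⟺ Sᴵ (update-same σ y₁ s)
    ×-⇔ (⊩∀O⇔ST⟺ φ y₂ y₁ σ s y₂≢y₁
    ×-⇔ (body s ⇔-∘ ⊩∀⇒⟺ y₃ (R y y₁ y₃) (ST y₃ ψ) (σ [ y₁ ↦ s ])))
    where
    open ST-variables y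
    module _ (s : D w) {v} (p : w ≤ v) (c : D v) where
      σ₁ = transport p (σ [ y₁ ↦ s ])
      ρ = σ₁ [ y₃ ↦ c ]
      ρy : ρ y ≡ H p (σ y)
      ρy = trans (update-other σ₁ c y₃≢y) (cong (H p) (update-other σ s y₁≢y))
      ρy₁ : ρ y₁ ≡ H p s
      ρy₁ = trans (update-other σ₁ c y₃≢y₁) (cong (H p) (update-same σ y₁ s))
      ρy₃ : ρ y₃ ≡ c
      ρy₃ = update-same σ₁ y₃ c
      at : (v , ρ ⊩ R y y₁ y₃ → v , ρ ⊩ ST y₃ ψ) ⟺ (Rᴵ (H p (σ y)) (H p s) c → ‖ ψ ‖ v c)
      at = →-cong-⇔ (⊩R⟺ {ρ = ρ} ρy ρy₁ ρy₃) (subst-⟺ (‖ ψ ‖ v) ρy₃ ⇔-∘ ST-correct ψ y₃ ρ)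
    body : ∀ s → (∀ {v} (p : w ≤ v) c → v , ρ s p c ⊩ R y y₁ y₃ → v , ρ s p c ⊩ ST y₃ ψ) ⟺
                 (∀ {v} (p : w ≤ v) c → Rᴵ (H p (σ y)) (H p s) c → ‖ ψ ‖ v c)
    body s = mk⇔ (λ f {v} p c → to (at s p c) (f p c))
                 (λ g {v} p c → from (at s p c) (g p c))
  ST-correct {w} (φ ◇→ ψ) y σ = Σ.congˡ {k = equivalence} λ {s} →
        subst-⟺ Sᴵ (update-same σ y₁ s)
    ×-⇔ (⊩∀O⇔ST⟺ φ y₂ y₁ σ s y₂≢y₁
    ×-⇔ Σ.congˡ {k = equivalence} λ {c} → at s c)
    where
    open ST-variables y
    module _ (s c : D w) where
      σ₁ = σ [ y₁ ↦ s ]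
      ρ = σ₁ [ y₃ ↦ c ]
      ρy : ρ y ≡ σ y
      ρy = trans (update-other σ₁ c y₃≢y) (update-other σ s y₁≢y)
      ρy₁ : ρ y₁ ≡ s
      ρy₁ = trans (update-other σ₁ c y₃≢y₁) (update-same σ y₁ s)
      ρy₃ : ρ y₃ ≡ c
      ρy₃ = update-same σ₁ y₃ c
      at : (w , ρ ⊩ (R y y₁ y₃ ∧ ST y₃ ψ)) ⟺ (Rᴵ (σ y) s c × ‖ ψ ‖ w c)
      at = ⊩R⟺ {ρ = ρ} ρy ρy₁ ρy₃ ×-⇔ (subst-⟺ (‖ ψ ‖ w) ρy₃ ⇔-∘ ST-correct ψ y₃ ρ)

  State : Pred w → Set
  State {w} Q = Σ (D w) λ s → Sᴵ s × Represents Q s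

  Th-mono : {σ : Assignment w} → (∀ χ → Th χ → w , σ ⊩ χ) →
            (p : w ≤ v) → ∀ χ → Th χ → v , transport p σ ⊩ χ
  Th-mono model p χ ax = ⊩-mono χ p (model χ ax)

  Closure : FO → FO
  Closure χ = ∀′ 0 (∀′ 1 ((S 0 ∧ S 1) ⇒ ∃′ 2 (S 2 ∧ ∀O 3 (E 3 2 ⇔ χ))))

  module Axioms {w} (σ : Assignment w) (model : ∀ χ → Th χ → w , σ ⊩ χ) where

    R-target-O : {a b c : D w} → Rᴵ a b c → Oᴵ c
    R-target-O {a} {b} {c} = proj₂ ∘ proj₂ ∘
      ⊩∀∀⇒-elim 1 2 R-args R-types (σ [ 0 ↦ a ])
        (⊩∀-elim 0 (∀′ 1 (∀′ 2 (R-args ⇒ R-types))) σ (model _ th-R) a) b c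
      where
      R-args R-types : FO
      R-args = R 0 1 2
      R-types = O 0 ∧ S 1 ∧ O 2

    Represents-unique : {Q : Pred w} {a b : D w} → Sᴵ a → Sᴵ b →
                        Represents Q a → Represents Q b → a ≡ b
    Represents-unique {a = a} {b} Sa Sb ra rb =
      ⊩∀∀⇒-elim 0 1 (S 0 ∧ S 1 ∧ ∀O 2 (E 2 0 ⇔ E 2 1)) (0 ≐ 1) σ (model _ th-ext) a b
        (Sa , Sb , from (⊩∀O⇔⟺ 2 0 (E 2 1) (σ [ 0 ↦ a ] [ 1 ↦ b ]) λ ())
                        λ p e o → ⇔-sym (rb p e o) ⇔-∘ ra p e o)

    private
      frame : D w → w ≤ v → D v → Assignment v
      frame s p e = transport p (σ [ 0 ↦ s ]) [ 1 ↦ e ]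

    var-state : ∀ q → State (‖ var q ‖ ↑)
    var-state q = let s , Ss , F = model _ (th-p q) in
      s , Ss , λ p e _ → mk⇔ (⊩⇒-elim (E 1 0) (P q 1) (frame s p e) (proj₁ (F _ p e)))
                             (⊩⇒-elim (P q 1) (E 1 0) (frame s p e) (proj₂ (F _ p e)))

    ⊤-state : State (‖ ⊤ᴸ ‖ ↑)
    ⊤-state = let s , Ss , F = model _ th-top in
      s , Ss , λ p e o →
        mk⇔ (λ _ → tt) (λ _ → ⊩⇒-elim (O 1) (E 1 0) (frame s p e) (F _ p e) o)

    ⊥-state : State (‖ ⊥ᴸ ‖ ↑)
    ⊥-state = let s , Ss , F = model _ th-bot in
      s , Ss , λ p e _ → mk⇔ (⊩⇒-elim (E 1 0) ⊥ᶠ (frame s p e) (F _ p e)) ⊥-elim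

    closure : ∀ χ → Th (Closure χ) → {a b : D w} → Sᴵ a → Sᴵ b →
              Σ (D w) λ z → Sᴵ z ×
                Represents (Forced (σ [ 0 ↦ a ] [ 1 ↦ b ] [ 2 ↦ z ]) 3 χ) z
    closure χ ax {a} {b} Sa Sb =
      let z , Sz , F = ⊩∀∀⇒-elim 0 1 (S 0 ∧ S 1) (∃′ 2 (S 2 ∧ ∀O 3 (E 3 2 ⇔ χ))) σ
                                  (model _ ax) a b (Sa , Sb)
      in z , Sz , to (⊩∀O⇔⟺ 3 2 χ (σ [ 0 ↦ a ] [ 1 ↦ b ] [ 2 ↦ z ]) λ ()) F

  ⇒ᴸ-⟺ : ∀ φ ψ {s₁ s₂ : D w} → Represents (‖ φ ‖ ↑) s₁ → Represents (‖ ψ ‖ ↑) s₂ →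
         (p : w ≤ v) (e : D v) → Oᴵ e →
         (∀ u (q : v ≤ u) → Eᴵ (H q e) (H q (H p s₁)) → Eᴵ (H q e) (H q (H p s₂))) ⟺
         ‖ φ ⇒ᴸ ψ ‖ v e
  ⇒ᴸ-⟺ {v = v} φ ψ {s₁} {s₂} r₁ r₂ p e o =
    mk⇔ (λ f u q → to (at q) (f u q)) (λ f u q → from (at q) (f u q))
    where
    at : ∀ {u} (q : v ≤ u) → (Eᴵ (H q e) (H q (H p s₁)) → Eᴵ (H q e) (H q (H p s₂))) ⟺
                             (‖ φ ‖ u (H q e) → ‖ ψ ‖ u (H q e))
    at q = →-cong-⇔ (Represents-mono r₁ p q (H q e) (H-O q e o))
                    (Represents-mono r₂ p q (H q e) (H-O q e o))

  module Representation {w} (σ : Assignment w) (model : ∀ χ → Th χ → w , σ ⊩ χ) where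
    open Axioms σ model

    module Later {v} (p : w ≤ v) = Axioms (transport p σ) (Th-mono model p)

    □→-⟺ : ∀ φ ψ (p : w ≤ v) {s₁ s₂ : D w} → Sᴵ s₁ →
          Represents (‖ φ ‖ ↑) s₁ → Represents (‖ ψ ‖ ↑) s₂ → ∀ e →
          (∀ {u} (q : v ≤ u) c → Rᴵ (H q e) (H q (H p s₁)) c → Eᴵ c (H q (H p s₂))) ⟺
          ‖ φ □→ ψ ‖ v e
    □→-⟺ {v = v} φ ψ p {s₁} {s₂} S₁ r₁ r₂ e = mk⇔ forward backward
      where
      Box : Set
      Box = ∀ {u} (q : v ≤ u) c → Rᴵ (H q e) (H q (H p s₁)) c → Eᴵ c (H q (H p s₂))

      r₂′ : ∀ {u} (q : v ≤ u) c → Rᴵ (H q e) (H q (H p s₁)) c →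
            Eᴵ c (H q (H p s₂)) ⟺ ‖ ψ ‖ u c
      r₂′ q c r = Represents-mono r₂ p q c (Later.R-target-O (≤-trans p q) r)

      forward : Box → ‖ φ □→ ψ ‖ v e
      forward k =
        H p s₁ , H-S p s₁ S₁ , Represents-mono r₁ p , λ q c r → to (r₂′ q c r) (k q c r)

      backward : ‖ φ □→ ψ ‖ v e → Box
      backward (s , Ss , rs , k) q c r =
        from (r₂′ q c r) (k q c (subst (λ t → Rᴵ (H q e) (H q t) c) (sym s≡) r))
        where
        s≡ : s ≡ H p s₁
        s≡ = Later.Represents-unique p Ss (H-S p s₁ S₁) rs (Represents-mono r₁ p)

    ◇→-⟺ : ∀ φ ψ (p : w ≤ v) {s₁ s₂ : D w} → Sᴵ s₁ →
          Represents (‖ φ ‖ ↑) s₁ → Represents (‖ ψ ‖ ↑) s₂ → ∀ e →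
          (Σ (D v) λ c → Rᴵ e (H p s₁) c × Eᴵ c (H p s₂)) ⟺ ‖ φ ◇→ ψ ‖ v e
    ◇→-⟺ {v = v} φ ψ p {s₁} {s₂} S₁ r₁ r₂ e = mk⇔ forward backward
      where
      Dia : Set
      Dia = Σ (D v) λ c → Rᴵ e (H p s₁) c × Eᴵ c (H p s₂)

      forward : Dia → ‖ φ ◇→ ψ ‖ v e
      forward (c , r , Ec) =
        H p s₁ , H-S p s₁ S₁ , Represents-mono r₁ p , c , r , to (r₂ p c (Later.R-target-O p r)) Ec

      backward : ‖ φ ◇→ ψ ‖ v e → Dia
      backward (s , Ss , rs , c , r , ψc) =
        c , subst (λ t → Rᴵ e t c) s≡ r , from (r₂ p c (Later.R-target-O p r)) ψc
        where
        s≡ : s ≡ H p s₁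
        s≡ = Later.Represents-unique p Ss (H-S p s₁ S₁) rs (Represents-mono r₁ p)

    -- The closure axioms use closed variable names, so
    -- Forced (σ [ 0 ↦ s₁ ] [ 1 ↦ s₂ ] [ 2 ↦ z ]) 3 χ p e computes to χ read with 3 ↦ e,
    -- 0 ↦ H p s₁ and 1 ↦ H p s₂ (e.g. Eᴵ e (H p s₁) × Eᴵ e (H p s₂) for χ = E 3 0 ∧ E 3 1).
    combine : ∀ {χ} {Q₁ Q₂ Q : Pred w} → Th (Closure χ) → State Q₁ → State Q₂ →
              (∀ {s₁ s₂ z} → Sᴵ s₁ → Represents Q₁ s₁ → Represents Q₂ s₂ →
               ∀ {v} (p : w ≤ v) e → Oᴵ e →
               Forced (σ [ 0 ↦ s₁ ] [ 1 ↦ s₂ ] [ 2 ↦ z ]) 3 χ p e ⟺ Q p e) →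
              State Q
    combine ax (s₁ , S₁ , r₁) (s₂ , S₂ , r₂) χ⟺Q =
      let z , Sz , rz = closure _ ax S₁ S₂
      in z , Sz , to (Represents-cong (χ⟺Q S₁ r₁ r₂)) rz

    represent : ∀ φ → State (‖ φ ‖ ↑)
    represent (var q) = var-state q
    represent ⊤ᴸ = ⊤-state
    represent ⊥ᴸ = ⊥-state
    represent (φ ∧ᴸ ψ) = combine (th-op and) (represent φ) (represent ψ)
      λ _ r₁ r₂ p e o → r₁ p e o ×-⇔ r₂ p e o
    represent (φ ∨ᴸ ψ) = combine (th-op or) (represent φ) (represent ψ)
      λ _ r₁ r₂ p e o → r₁ p e o ⊎-⇔ r₂ p e o
    represent (φ ⇒ᴸ ψ) = combine (th-op imp) (represent φ) (represent ψ)
      λ _ r₁ r₂ → ⇒ᴸ-⟺ φ ψ r₁ r₂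
    represent (φ □→ ψ) = combine th-box (represent φ) (represent ψ)
      λ {s₁} {s₂} {z} S₁ r₁ r₂ p e _ → □→-⟺ φ ψ p S₁ r₁ r₂ e
        ⇔-∘ ⊩∀⇒⟺ 4 (R 3 0 4) (E 4 1)
                  (transport p (σ [ 0 ↦ s₁ ] [ 1 ↦ s₂ ] [ 2 ↦ z ]) [ 3 ↦ e ])
    represent (φ ◇→ ψ) = combine th-dia (represent φ) (represent ψ)
      λ S₁ r₁ r₂ p e _ → ◇→-⟺ φ ψ p S₁ r₁ r₂ e

    ⊩ST-extension : ∀ φ x y → x ≢ y → w , σ ⊩ ∃′ x (S x ∧ ∀O y (E y x ⇔ ST y φ))
    ⊩ST-extension φ x y x≢y =
      let s , Ss , rep = represent φ
      in s , subst Sᴵ (sym (update-same σ x s)) Ss ,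
         from (⊩∀O⇔ST⟺ φ y x σ s (x≢y ∘ sym)) rep

lemma16 : (φ : 𝓛) (x y : IVar) → x ≢ y →
    Th ⊨fo ⟦ ∃′ x (S x ∧ ∀O y (E y x ⇔ ST y φ)) ⟧
lemma16 φ x y x≢y M w σ model refute =
  refute _ refl (Semantics.Representation.⊩ST-extension M σ model φ x y x≢y)
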